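{- Let $n \geqslant 12$ be an integer and let $E_n=\{x_i+x_j=x_k,~x_i \cdot x_j=x_k \colon i,j,k \in \{1,\ldots,n\}\}$. Let $T_n$ be the following system of equations in the variables $x_1,\ldots,x_n$: \[ \left\{\begin{array}{rcl} \forall i \in \{1,\ldots,n-12\} ~x_i \cdot x_i &=& x_{i+1} \\ x_{n-10} \cdot x_{n-10} &=& x_{n-10} \\ x_{n-10}+x_{n-10} &=& x_{n-9} \\ x_{n-8}+x_{n-9} &=& x_{1} \\ x_{n-8} \cdot x_{n-7} &=& x_{n-11} \\ x_{n-10} \cdot x_{n-7} &=& x_{n-7} \\ x_{n-6} \cdot x_{n-6} &=& x_{n-5} \\ x_{n-4} \cdot x_{n-4} &=& x_{n-3} \\ x_{n-2} \cdot x_{n-2} &=& x_{n-1} \\ x_{n-5}+x_{n-3} &=& x_n \\ x_{n-1}+x_n &=& x_{n-11} \end{array}\right. \] Then $T_n \subseteq E_n$, and $T_n$ has exactly \[ 1+\sum_{k=0}^{2^{n-12}} \left( r_3\!\left(\left(2+2^k\right)^{2^{n-12}}\right) + r_3\!\left(\left(2-2^k\right)^{2^{n-12}}\right)\right) \] solutions in integers $x_1,\ldots,x_n$ (the paper writes this sum as $1+\sum_{k=0}^{2^{n-12}} r_3\left(\left(2 \pm 2^k\right)^{2^{n-12}}\right)$, the sum running over both signs).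
   Context: For a non-negative integer $m$, $r_3(m)$ denotes the number of triples $(a,b,c)\in\mathbb Z^3$ with $a^2+b^2+c^2=m$. -}

module Defs where

open import Data.Nat using (ℕ; zero; suc; _∸_; _≤_)
open import Data.Integer using (ℤ; +_) renaming (_+_ to _+ℤ_; _*_ to _*ℤ_)
open import Data.List using (List; []; _∷_; map; upTo; _++_)
open import Data.List.Relation.Unary.All using (All)
open import Data.Vec using (Vec; []; _∷_)
open import Data.Fin using (Fin)
open import Data.Product using (Σ; _×_)
open import Function.Bundles using (_↔_)
open import Relation.Binary.PropositionalEquality using (_≡_)

-- An equation in variables x_1, x_2, ... (1-based indices):
--   add i j k  means  x_i + x_j = x_k
--   mul i j k  means  x_i · x_j = x_k
data Equation : Set where
  add : ℕ → ℕ → ℕ → Equation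
  mul : ℕ → ℕ → ℕ → Equation

InRange : ℕ → ℕ → Set
InRange n i = (1 ≤ i) × (i ≤ n)

InE : ℕ → Equation → Set
InE n (add i j k) = InRange n i × InRange n j × InRange n k
InE n (mul i j k) = InRange n i × InRange n j × InRange n k

T : ℕ → List Equation
T n =
  map (λ i → mul i i (suc i)) (map suc (upTo (n ∸ 12)))
  ++ ( mul (n ∸ 10) (n ∸ 10) (n ∸ 10)
     ∷ add (n ∸ 10) (n ∸ 10) (n ∸ 9)
     ∷ add (n ∸ 8) (n ∸ 9) 1
     ∷ mul (n ∸ 8) (n ∸ 7) (n ∸ 11)
     ∷ mul (n ∸ 10) (n ∸ 7) (n ∸ 7)
     ∷ mul (n ∸ 6) (n ∸ 6) (n ∸ 5)
     ∷ mul (n ∸ 4) (n ∸ 4) (n ∸ 3)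
     ∷ mul (n ∸ 2) (n ∸ 2) (n ∸ 1)
     ∷ add (n ∸ 5) (n ∸ 3) n
     ∷ add (n ∸ 1) n (n ∸ 11)
     ∷ [] )

-- value of the variable x_i (1-based) in an assignment; 0 if out of range
-- (never used out of range for T_n, since T_n ⊆ E_n)
get : {n : ℕ} → Vec ℤ n → ℕ → ℤ
get [] _ = + 0
get (a ∷ v) zero = + 0
get (a ∷ v) (suc zero) = a
get (a ∷ v) (suc (suc i)) = get v (suc i)

Sat : {n : ℕ} → Vec ℤ n → Equation → Set
Sat x (add i j k) = get x i +ℤ get x j ≡ get x k
Sat x (mul i j k) = get x i *ℤ get x j ≡ get x k

Solution : ℕ → Set
Solution n = Σ (Vec ℤ n) (λ x → All (Sat x) (T n))

Triple : ℤ → Set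
Triple m = Σ ℤ (λ a → Σ ℤ (λ b → Σ ℤ (λ c → (a *ℤ a) +ℤ (b *ℤ b) +ℤ (c *ℤ c) ≡ m)))

IsR3 : (ℤ → ℕ) → Set
IsR3 r = (m : ℤ) → Fin (r m) ↔ Triple m

-- The n − 12 squaring equations force x_{n−11} = x₁^N with N = 2^{n−12}, so a solution is
-- determined by x₁ and the last eleven variables. Since x_{n−10} is idempotent it is 0 or 1.
-- If it is 0, then x_{n−7} = 0, so x₁^N = 0 and everything vanishes: this is the solution
-- counted by the 1. If it is 1, then x_{n−9} = 2 and d := x_{n−8} satisfies x₁ = 2 + d and
-- d · x_{n−7} = (2 + d)^N. As (2 + d)^N ≡ 2^N (mod d), such a cofactor x_{n−7} exists (and
-- is then unique) exactly when d ∣ 2^N, i.e. d = ±2^j with j ≤ N. The remaining variables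
-- encode an arbitrary representation x_{n−6}² + x_{n−4}² + x_{n−2}² = (2 ± 2^j)^N.

{-# OPTIONS --safe #-}
module Submission where

open import Defs
open import Data.Nat using (ℕ; zero; suc; _+_; _*_; _∸_; _^_; _≤_; _<_; z≤n; s≤s; NonZero; _≤?_; ≢-nonZero⁻¹)
import Data.Nat.Properties as ℕ
open import Data.Nat.Divisibility using (_∣_; divides; _∣?_; ∣1⇒≡1; *-cancelˡ-∣)
open import Data.Nat.Coprimality using (Coprime; coprime-divisor)
open import Data.Nat.Primality using (Prime; prime[2]; prime⇒irreducible; prime⇒nonZero)
open import Data.Nat.ListAction using (sum)
open import Data.Integer using (ℤ; +_; -[1+_]; -_; ∣_∣) renaming (≢-nonZero to ≢-nonZeroℤ; _+_ to _+ℤ_; _-_ to _-ℤ_; _^_ to _^ℤ_; _*_ to _*ℤ_)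
import Data.Integer.Properties as ℤ
open import Data.Integer.Tactic.RingSolver using (solve-∀)
open import Data.List using (List; []; _∷_; map; upTo; applyUpTo)
open import Data.List.Properties using (map-upTo)
open import Data.List.Relation.Unary.All as All using (All; []; _∷_; all?)
open import Data.List.Relation.Unary.All.Properties using (map⁺; map⁻; ++⁺; ++⁻ˡ; ++⁻ʳ; applyUpTo⁺₁; applyUpTo⁻)
open import Data.Vec using (Vec; []; _∷_; replicate)
open import Data.Fin using (Fin)
open import Data.Fin.Properties using (+↔⊎; 1↔⊤)
open import Data.Product using (Σ; ∃-syntax; _×_; _,_; proj₂)
open import Data.Product.Function.NonDependent.Propositional using (_×-↔_)
open import Data.Product.Function.Dependent.Propositional using (Σ-↔)
open import Data.Sum using (_⊎_; inj₁; inj₂; [_,_]′)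
open import Data.Sum.Function.Propositional using (_⊎-↔_)
open import Data.Unit using (⊤; tt)
open import Function using (_∘_; id)
open import Function.Bundles using (_↔_; _⇔_; mk↔ₛ′; mk⇔; Equivalence)
open import Function.Properties.Inverse using (↔-refl; ↔-sym; ↔-trans)
open import Function.Related.Propositional using (module EquationalReasoning)
open import Axiom.UniquenessOfIdentityProofs using (module Decidable⇒UIP)
open import Relation.Binary.PropositionalEquality
open import Relation.Nullary using (yes; no; ¬_; contradiction)
open import Relation.Nullary.Decidable using (toWitness; _×-dec_)
open import Relation.Unary using (Decidable; Irrelevant)

open Decidable⇒UIP ℤ._≟_ using (≡-irrelevant)

Σ-≡-irrelevant : {A : Set} {P : A → Set} → Irrelevant P →
                 ∀ {a b} {p : P a} {q : P b} → a ≡ b → (a , p) ≡ (b , q)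
Σ-≡-irrelevant irr {p = p} {q} refl = cong (_ ,_) (irr p q)

Σ-↔-irrelevant : {A B : Set} {P : A → Set} {Q : B → Set} → Irrelevant P → Irrelevant Q →
  (f : A → B) (g : B → A) → (∀ {a} → P a → Q (f a)) → (∀ {b} → Q b → P (g b)) →
  (∀ {b} → Q b → f (g b) ≡ b) → (∀ {a} → P a → g (f a) ≡ a) → Σ A P ↔ Σ B Q
Σ-↔-irrelevant P-irr Q-irr f g P⇒Q Q⇒P f∘g g∘f = mk↔ₛ′
  (λ (a , p) → f a , P⇒Q p) (λ (b , q) → g b , Q⇒P q)
  (λ (_ , q) → Σ-≡-irrelevant Q-irr (f∘g q)) (λ (_ , p) → Σ-≡-irrelevant P-irr (g∘f p))

Σ<suc↔⊎ : (X : ℕ → Set) (n : ℕ) →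
  Σ ℕ (λ j → j < suc n × X j) ↔ (X 0 ⊎ Σ ℕ (λ j → j < n × X (suc j)))
Σ<suc↔⊎ X n = mk↔ₛ′ split merge split∘merge merge∘split
  where
  split : Σ ℕ (λ j → j < suc n × X j) → X 0 ⊎ Σ ℕ (λ j → j < n × X (suc j))
  split (zero , _ , x) = inj₁ x
  split (suc j , s≤s j<n , x) = inj₂ (j , j<n , x)
  merge : X 0 ⊎ Σ ℕ (λ j → j < n × X (suc j)) → Σ ℕ (λ j → j < suc n × X j)
  merge (inj₁ x) = 0 , s≤s z≤n , x
  merge (inj₂ (j , j<n , x)) = suc j , s≤s j<n , x
  split∘merge : ∀ y → split (merge y) ≡ y
  split∘merge (inj₁ _) = refl
  split∘merge (inj₂ _) = refl
  merge∘split : ∀ y → merge (split y) ≡ y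
  merge∘split (zero , s≤s z≤n , _) = refl
  merge∘split (suc _ , s≤s _ , _) = refl

Fin-sum↔Σ< : (f : ℕ → ℕ) (n : ℕ) → Fin (sum (applyUpTo f n)) ↔ Σ ℕ (λ j → j < n × Fin (f j))
Fin-sum↔Σ< f zero = mk↔ₛ′ (λ ()) (λ { (_ , () , _) }) (λ { (_ , () , _) }) (λ ())
Fin-sum↔Σ< f (suc n) =
  ↔-trans +↔⊎ (↔-trans (↔-refl ⊎-↔ Fin-sum↔Σ< (f ∘ suc) n) (↔-sym (Σ<suc↔⊎ (Fin ∘ f) n)))

-- Same as ℕ.m≤n⇒∃[o]m+o≡n, but its witness does not unfold to n ∸ m, which makes the
-- with-abstraction in theorem2 far cheaper to check.
m≤n⇒∃[k]m+k≡n : ∀ {m n} → m ≤ n → ∃[ k ] m + k ≡ n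
m≤n⇒∃[k]m+k≡n {n = n} z≤n = n , refl
m≤n⇒∃[k]m+k≡n (s≤s m≤n) = let k , m+k≡n = m≤n⇒∃[k]m+k≡n m≤n in k , cong suc m+k≡n

^-injectiveʳ : ∀ {b m n} → 1 < b → b ^ m ≡ b ^ n → m ≡ n
^-injectiveʳ {b} {m} {n} 1<b b^m≡b^n = ℕ.≤-antisym
  (ℕ.≮⇒≥ λ n<m → ℕ.<-irrefl (sym b^m≡b^n) (ℕ.^-monoʳ-< b 1<b n<m))
  (ℕ.≮⇒≥ λ m<n → ℕ.<-irrefl b^m≡b^n (ℕ.^-monoʳ-< b 1<b m<n))

prime∤⇒coprime : ∀ {p m} → Prime p → ¬ p ∣ m → Coprime m p
prime∤⇒coprime pp p∤m (d∣m , d∣p) =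
  [ id , (λ d≡p → contradiction (subst (_∣ _) d≡p d∣m) p∤m) ]′ (prime⇒irreducible pp d∣p)

∣p^n⇒≡p^j : ∀ {p m} n → Prime p → m ∣ p ^ n → ∃[ j ] j ≤ n × m ≡ p ^ j
∣p^n⇒≡p^j zero _ m∣1 = 0 , z≤n , ∣1⇒≡1 m∣1
∣p^n⇒≡p^j {p} {m} (suc n) pp m∣p^[1+n] with p ∣? m
... | yes (divides q refl) =
  let j , j≤n , q≡p^j = ∣p^n⇒≡p^j n pp q∣p^n
  in suc j , s≤s j≤n , trans (cong (_* p) q≡p^j) (ℕ.*-comm (p ^ j) p)
  where
  instance _ = prime⇒nonZero pp
  q∣p^n = *-cancelˡ-∣ p (subst (_∣ p ^ suc n) (ℕ.*-comm q p) m∣p^[1+n])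
... | no p∤m =
  let j , j≤n , m≡p^j = ∣p^n⇒≡p^j n pp (coprime-divisor (prime∤⇒coprime pp p∤m) m∣p^[1+n])
  in j , ℕ.m≤n⇒m≤1+n j≤n , m≡p^j

pos-^ : ∀ m n → (+ m) ^ℤ n ≡ + (m ^ n)
pos-^ m zero = refl
pos-^ m (suc n) = trans (cong (+ m *ℤ_) (pos-^ m n)) (sym (ℤ.pos-* m (m ^ n)))

0^n≡0 : ∀ n .{{_ : NonZero n}} → (+ 0) ^ℤ n ≡ + 0
0^n≡0 (suc n) = refl

[i+j]^n≡i^n+j*t : ∀ i j n → ∃[ t ] (i +ℤ j) ^ℤ n ≡ i ^ℤ n +ℤ j *ℤ t
[i+j]^n≡i^n+j*t i j zero = + 0 , cong (+ 1 +ℤ_) (sym (ℤ.*-zeroʳ j))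
[i+j]^n≡i^n+j*t i j (suc n) =
  let t , [i+j]^n≡ = [i+j]^n≡i^n+j*t i j n
  in i ^ℤ n +ℤ (i +ℤ j) *ℤ t , trans (cong ((i +ℤ j) *ℤ_) [i+j]^n≡) (expand i j (i ^ℤ n) t)
  where
  expand : ∀ i j a t → (i +ℤ j) *ℤ (a +ℤ j *ℤ t) ≡ i *ℤ a +ℤ j *ℤ (a +ℤ (i +ℤ j) *ℤ t)
  expand = solve-∀

*-idem⇒0∨1 : ∀ i → i *ℤ i ≡ i → i ≡ + 0 ⊎ i ≡ + 1
*-idem⇒0∨1 (+ 0) _ = inj₁ refl
*-idem⇒0∨1 (+ 1) _ = inj₂ refl
*-idem⇒0∨1 (+ m@(suc (suc n))) m*m≡m
  with ℕ.*-cancelʳ-≡ m 1 m (trans (ℤ.+-injective (trans (ℤ.pos-* m m) m*m≡m)) (sym (ℕ.*-identityˡ m)))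
... | ()
*-idem⇒0∨1 -[1+ n ] ()

i*i≡+∣i∣*∣i∣ : ∀ i → i *ℤ i ≡ + (∣ i ∣ * ∣ i ∣)
i*i≡+∣i∣*∣i∣ (+ n) = sym (ℤ.pos-* n n)
i*i≡+∣i∣*∣i∣ -[1+ n ] = refl

sum-of-squares≡0 : ∀ a b c → a *ℤ a +ℤ b *ℤ b +ℤ c *ℤ c ≡ + 0 → a ≡ + 0 × b ≡ + 0 × c ≡ + 0
sum-of-squares≡0 a b c a²+b²+c²≡0 =
  ∣i∣*∣i∣≡0⇒i≡0 a (ℕ.m+n≡0⇒m≡0 _ A+B≡0) ,
  ∣i∣*∣i∣≡0⇒i≡0 b (ℕ.m+n≡0⇒n≡0 _ A+B≡0) ,
  ∣i∣*∣i∣≡0⇒i≡0 c (ℕ.m+n≡0⇒n≡0 _ A+B+C≡0)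
  where
  A+B+C≡0 : ∣ a ∣ * ∣ a ∣ + ∣ b ∣ * ∣ b ∣ + ∣ c ∣ * ∣ c ∣ ≡ 0
  A+B+C≡0 = ℤ.+-injective (trans (sym (cong₂ _+ℤ_ (cong₂ _+ℤ_ (i*i≡+∣i∣*∣i∣ a) (i*i≡+∣i∣*∣i∣ b))
                                                   (i*i≡+∣i∣*∣i∣ c)))
                                 a²+b²+c²≡0)
  A+B≡0 = ℕ.m+n≡0⇒m≡0 _ A+B+C≡0
  ∣i∣*∣i∣≡0⇒i≡0 : ∀ i → ∣ i ∣ * ∣ i ∣ ≡ 0 → i ≡ + 0
  ∣i∣*∣i∣≡0⇒i≡0 i e = [ id , id ]′ (ℤ.i*j≡0⇒i≡0∨j≡0 i (trans (i*i≡+∣i∣*∣i∣ i) (cong +_ e)))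

-- Divisors of powers of two

_≡±2^_ : ℤ → ℕ → Set
d ≡±2^ j = d ≡ (+ 2) ^ℤ j ⊎ d ≡ - ((+ 2) ^ℤ j)

SignedPowerOfTwo : ℕ → ℤ → Set
SignedPowerOfTwo N d = ∃[ j ] j ≤ N × d ≡±2^ j

2^≢0 : ∀ n → (+ 2) ^ℤ n ≢ + 0
2^≢0 n 2^n≡0 = ≢-nonZero⁻¹ (2 ^ n) {{ℕ.m^n≢0 2 n}} (ℤ.+-injective (trans (sym (pos-^ 2 n)) 2^n≡0))

2^-injective : ∀ {m n} → (+ 2) ^ℤ m ≡ (+ 2) ^ℤ n → m ≡ n
2^-injective {m} {n} 2^m≡2^n =
  ^-injectiveʳ (s≤s (s≤s z≤n)) (ℤ.+-injective (trans (sym (pos-^ 2 m)) (trans 2^m≡2^n (pos-^ 2 n))))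

+≢-+ : ∀ m n .{{_ : NonZero n}} → + m ≢ - (+ n)
+≢-+ m (suc n) ()

2^≢-2^ : ∀ m n → (+ 2) ^ℤ m ≢ - ((+ 2) ^ℤ n)
2^≢-2^ m n 2^m≡-2^n = +≢-+ (2 ^ m) (2 ^ n) {{ℕ.m^n≢0 2 n}}
  (trans (sym (pos-^ 2 m)) (trans 2^m≡-2^n (cong -_ (pos-^ 2 n))))

≡±2^-exponent : ∀ {d j k} → d ≡±2^ j → d ≡±2^ k → j ≡ k
≡±2^-exponent (inj₁ d≡) (inj₁ d≡′) = 2^-injective (trans (sym d≡) d≡′)
≡±2^-exponent (inj₂ d≡) (inj₂ d≡′) = 2^-injective (ℤ.neg-injective (trans (sym d≡) d≡′))
≡±2^-exponent {j = j} {k} (inj₁ d≡) (inj₂ d≡′) = contradiction (trans (sym d≡) d≡′) (2^≢-2^ j k)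
≡±2^-exponent {j = j} {k} (inj₂ d≡) (inj₁ d≡′) = contradiction (trans (sym d≡′) d≡) (2^≢-2^ k j)

≡±2^-irrelevant : ∀ {j} → Irrelevant (_≡±2^ j)
≡±2^-irrelevant (inj₁ d≡) (inj₁ d≡′) = cong inj₁ (≡-irrelevant d≡ d≡′)
≡±2^-irrelevant (inj₂ d≡) (inj₂ d≡′) = cong inj₂ (≡-irrelevant d≡ d≡′)
≡±2^-irrelevant {j = j} (inj₁ d≡) (inj₂ d≡′) = contradiction (trans (sym d≡) d≡′) (2^≢-2^ j j)
≡±2^-irrelevant {j = j} (inj₂ d≡) (inj₁ d≡′) = contradiction (trans (sym d≡′) d≡) (2^≢-2^ j j)

signedPowerOfTwo-irrelevant : ∀ {N} → Irrelevant (SignedPowerOfTwo N)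
signedPowerOfTwo-irrelevant (j , j≤N , d≡) (k , k≤N , d≡′) with ≡±2^-exponent {j = j} {k} d≡ d≡′
... | refl = cong₂ (λ j≤N d≡ → j , j≤N , d≡) (ℕ.≤-irrelevant j≤N k≤N) (≡±2^-irrelevant {j} d≡ d≡′)

∣i∣≡2^j⇒≡±2^j : ∀ i j → ∣ i ∣ ≡ 2 ^ j → i ≡±2^ j
∣i∣≡2^j⇒≡±2^j (+ m) j m≡2^j = inj₁ (trans (cong +_ m≡2^j) (sym (pos-^ 2 j)))
∣i∣≡2^j⇒≡±2^j -[1+ m ] j 1+m≡2^j = inj₂ (cong -_ (trans (cong +_ 1+m≡2^j) (sym (pos-^ 2 j))))

-- Opaque because only its statement matters; unfolding it makes the round trips in
-- cofactorTriples↔powerTriples very slow to check.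
opaque
  *≡2^⇒signedPowerOfTwo : ∀ {N d e} → d *ℤ e ≡ (+ 2) ^ℤ N → SignedPowerOfTwo N d
  *≡2^⇒signedPowerOfTwo {N} {d} {e} de≡2^N =
    let j , j≤N , ∣d∣≡2^j = ∣p^n⇒≡p^j N prime[2] ∣d∣∣2^N in j , j≤N , ∣i∣≡2^j⇒≡±2^j d j ∣d∣≡2^j
    where
    ∣d∣∣2^N : ∣ d ∣ ∣ 2 ^ N
    ∣d∣∣2^N = divides ∣ e ∣ (begin
      2 ^ N            ≡⟨ cong ∣_∣ (trans (sym (pos-^ 2 N)) (sym de≡2^N)) ⟩
      ∣ d *ℤ e ∣       ≡⟨ ℤ.abs-* d e ⟩
      ∣ d ∣ * ∣ e ∣    ≡⟨ ℕ.*-comm ∣ d ∣ ∣ e ∣ ⟩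
      ∣ e ∣ * ∣ d ∣    ∎)
      where open ≡-Reasoning

2^j*2^[n∸j]≡2^n : ∀ {j n} → j ≤ n → (+ 2) ^ℤ j *ℤ (+ 2) ^ℤ (n ∸ j) ≡ (+ 2) ^ℤ n
2^j*2^[n∸j]≡2^n {j} {n} j≤n =
  trans (sym (ℤ.^-distribˡ-+-* (+ 2) j (n ∸ j))) (cong ((+ 2) ^ℤ_) (ℕ.m+[n∸m]≡n j≤n))

signedPowerOfTwo⇒*≡2^ : ∀ {N d} → SignedPowerOfTwo N d → ∃[ e ] d *ℤ e ≡ (+ 2) ^ℤ N
signedPowerOfTwo⇒*≡2^ {N} (j , j≤N , inj₁ refl) = (+ 2) ^ℤ (N ∸ j) , 2^j*2^[n∸j]≡2^n j≤N
signedPowerOfTwo⇒*≡2^ {N} (j , j≤N , inj₂ refl) =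
  - ((+ 2) ^ℤ (N ∸ j)) , trans (neg*neg ((+ 2) ^ℤ j) ((+ 2) ^ℤ (N ∸ j))) (2^j*2^[n∸j]≡2^n j≤N)
  where
  neg*neg : ∀ a b → (- a) *ℤ (- b) ≡ a *ℤ b
  neg*neg = solve-∀

Cofactor : ℕ → ℤ → Set
Cofactor N d = ∃[ q ] d *ℤ q ≡ ((+ 2) +ℤ d) ^ℤ N

cofactor⇒*≡2^ : ∀ {N d} → Cofactor N d → ∃[ e ] d *ℤ e ≡ (+ 2) ^ℤ N
cofactor⇒*≡2^ {N} {d} (q , dq≡) =
  let t , [2+d]^N≡ = [i+j]^n≡i^n+j*t (+ 2) d N in q -ℤ t , (begin
    d *ℤ (q -ℤ t)                            ≡⟨ distrib d q t ⟩
    d *ℤ q -ℤ d *ℤ t                          ≡⟨ cong (_-ℤ d *ℤ t) (trans dq≡ [2+d]^N≡) ⟩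
    (+ 2) ^ℤ N +ℤ d *ℤ t -ℤ d *ℤ t            ≡⟨ cancel ((+ 2) ^ℤ N) (d *ℤ t) ⟩
    (+ 2) ^ℤ N                                 ∎)
  where
  open ≡-Reasoning
  distrib : ∀ d q t → d *ℤ (q -ℤ t) ≡ d *ℤ q -ℤ d *ℤ t
  distrib = solve-∀
  cancel : ∀ a b → a +ℤ b -ℤ b ≡ a
  cancel = solve-∀

*≡2^⇒cofactor : ∀ {N d e} → d *ℤ e ≡ (+ 2) ^ℤ N → Cofactor N d
*≡2^⇒cofactor {N} {d} {e} de≡2^N =
  let t , [2+d]^N≡ = [i+j]^n≡i^n+j*t (+ 2) d N in e +ℤ t , (begin
    d *ℤ (e +ℤ t)          ≡⟨ ℤ.*-distribˡ-+ d e t ⟩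
    d *ℤ e +ℤ d *ℤ t        ≡⟨ cong (_+ℤ d *ℤ t) de≡2^N ⟩
    (+ 2) ^ℤ N +ℤ d *ℤ t    ≡⟨ [2+d]^N≡ ⟨
    ((+ 2) +ℤ d) ^ℤ N       ∎)
  where open ≡-Reasoning

cofactor⇒≢0 : ∀ {N d} → Cofactor N d → d ≢ + 0
cofactor⇒≢0 {N} (_ , 0≡2^N) refl = 2^≢0 N (sym 0≡2^N)

cofactor-irrelevant : ∀ {N} → Irrelevant (Cofactor N)
cofactor-irrelevant {N} {d} c@(q , dq≡) (r , dr≡) = Σ-≡-irrelevant (λ {_} → ≡-irrelevant)
  (ℤ.*-cancelˡ-≡ d q r {{≢-nonZeroℤ (cofactor⇒≢0 {N} {d} c)}} (trans dq≡ (sym dr≡)))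

cofactor⇒signedPowerOfTwo : ∀ {N d} → Cofactor N d → SignedPowerOfTwo N d
cofactor⇒signedPowerOfTwo {N} {d} c = *≡2^⇒signedPowerOfTwo {N} {d} (proj₂ (cofactor⇒*≡2^ {N} {d} c))

signedPowerOfTwo⇒cofactor : ∀ {N d} → SignedPowerOfTwo N d → Cofactor N d
signedPowerOfTwo⇒cofactor {N} {d} s = *≡2^⇒cofactor {N} {d} (proj₂ (signedPowerOfTwo⇒*≡2^ {N} {d} s))

rename : (ℕ → ℕ) → Equation → Equation
rename ρ (add i j k) = add (ρ i) (ρ j) (ρ k)
rename ρ (mul i j k) = mul (ρ i) (ρ j) (ρ k)

Sat-rename : ∀ {m n} {u : Vec ℤ m} {v : Vec ℤ n} (ρ : ℕ → ℕ) →
  (∀ i → get v (ρ i) ≡ get u i) → ∀ e → Sat v (rename ρ e) ≡ Sat u e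
Sat-rename ρ agree (add i j k) = cong₂ _≡_ (cong₂ _+ℤ_ (agree i) (agree j)) (agree k)
Sat-rename ρ agree (mul i j k) = cong₂ _≡_ (cong₂ _*ℤ_ (agree i) (agree j)) (agree k)

All-Sat-rename : ∀ {m n} {u : Vec ℤ m} {v : Vec ℤ n} (ρ : ℕ → ℕ) →
  (∀ i → get v (ρ i) ≡ get u i) → ∀ es → All (Sat v) (map (rename ρ) es) ⇔ All (Sat u) es
All-Sat-rename ρ agree es = mk⇔
  (All.map (λ {e} → subst id (Sat-rename ρ agree e)) ∘ map⁻)
  (map⁺ ∘ All.map (λ {e} → subst id (sym (Sat-rename ρ agree e))))

Sat-irrelevant : ∀ {n} {v : Vec ℤ n} → Irrelevant (Sat v)
Sat-irrelevant {x = add _ _ _} = ≡-irrelevant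
Sat-irrelevant {x = mul _ _ _} = ≡-irrelevant

rename-InE : ∀ {l m} {ρ : ℕ → ℕ} → (∀ {i} → InRange l i → InRange m (ρ i)) →
  ∀ {e} → InE l e → InE m (rename ρ e)
rename-InE ρ-range {add _ _ _} (ri , rj , rk) = ρ-range ri , ρ-range rj , ρ-range rk
rename-InE ρ-range {mul _ _ _} (ri , rj , rk) = ρ-range ri , ρ-range rj , ρ-range rk

InRange? : ∀ n → Decidable (InRange n)
InRange? n i = 1 ≤? i ×-dec i ≤? n

InE? : ∀ n → Decidable (InE n)
InE? n (add i j k) = InRange? n i ×-dec InRange? n j ×-dec InRange? n k
InE? n (mul i j k) = InRange? n i ×-dec InRange? n j ×-dec InRange? n k

chainSystem : ℕ → List Equation
chainSystem k = map (λ i → mul i i (suc i)) (map suc (upTo k))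

All-chainSystem⇔ : ∀ {P : Equation → Set} k →
  All P (chainSystem k) ⇔ (∀ {i} → i < k → P (mul (suc i) (suc i) (suc (suc i))))
All-chainSystem⇔ {P} k = mk⇔ to from
  where
  to : All P (chainSystem k) → ∀ {i} → i < k → P (mul (suc i) (suc i) (suc (suc i)))
  to all = applyUpTo⁻ id k (map⁻ (map⁻ all))
  from : (∀ {i} → i < k → P (mul (suc i) (suc i) (suc (suc i)))) → All P (chainSystem k)
  from ps = map⁺ (map⁺ (applyUpTo⁺₁ id k ps))

-- Variables 1, 2, 3, …, 13 of tailSystem stand for x₁, x_{n-11}, x_{n-10}, …, x_n;
-- T (12 + k) is definitionally chainSystem k ++ map (rename (tailIndex k)) tailSystem.
tailSystem : List Equation
tailSystem =
  mul 3 3 3 ∷ add 3 3 4 ∷ add 5 4 1 ∷ mul 5 6 2 ∷ mul 3 6 6 ∷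
  mul 7 7 8 ∷ mul 9 9 10 ∷ mul 11 11 12 ∷ add 8 10 13 ∷ add 12 13 2 ∷ []

tailIndex : ℕ → ℕ → ℕ
tailIndex k zero = zero
tailIndex k (suc zero) = 1
tailIndex k (suc (suc i)) = suc i + k

tailIndex-inRange : ∀ k {i} → InRange 13 i → InRange (12 + k) (tailIndex k i)
tailIndex-inRange k {zero} (() , _)
tailIndex-inRange k {suc zero} _ = s≤s z≤n , s≤s z≤n
tailIndex-inRange k {suc (suc i)} (_ , s≤s i<12) = s≤s z≤n , ℕ.+-monoˡ-≤ k i<12

inRange-prefix : ∀ k {i} → i ≤ k → InRange (12 + k) (suc i)
inRange-prefix k i≤k = s≤s z≤n , s≤s (ℕ.≤-trans i≤k (ℕ.m≤n+m k 11))

T⊆E : ∀ k → All (InE (12 + k)) (T (12 + k))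
T⊆E k = ++⁺ (Equivalence.from (All-chainSystem⇔ k) chainInE)
            (map⁺ (All.map (rename-InE (tailIndex-inRange k)) tailInE))
  where
  chainInE : ∀ {i} → i < k → InE (12 + k) (mul (suc i) (suc i) (suc (suc i)))
  chainInE i<k = inRange-prefix k (ℕ.<⇒≤ i<k) , inRange-prefix k (ℕ.<⇒≤ i<k) , inRange-prefix k i<k
  tailInE : All (InE 13) tailSystem
  tailInE = toWitness {a? = all? (InE? 13) tailSystem} tt

-- Elimination of the squaring chain

get-zero : ∀ {n} (v : Vec ℤ n) → get v 0 ≡ + 0
get-zero [] = refl
get-zero (_ ∷ _) = refl

squares : ∀ k → ℤ → Vec ℤ (suc k)
squares zero x = x ∷ []
squares (suc k) x = x ∷ squares k (x *ℤ x)

IsSquareChain : ∀ {k} → Vec ℤ (suc k) → Set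
IsSquareChain {k} p = ∀ {i} → i < k → get p (suc i) *ℤ get p (suc i) ≡ get p (suc (suc i))

get-squares-head : ∀ k x → get (squares k x) 1 ≡ x
get-squares-head zero x = refl
get-squares-head (suc k) x = refl

get-squares-last : ∀ k x → get (squares k x) (suc k) ≡ x ^ℤ (2 ^ k)
get-squares-last zero x = sym (ℤ.^-identityʳ x)
get-squares-last (suc k) x = begin
  get (squares k (x *ℤ x)) (suc k) ≡⟨ get-squares-last k (x *ℤ x) ⟩
  (x *ℤ x) ^ℤ (2 ^ k)               ≡⟨ cong (λ y → (x *ℤ y) ^ℤ (2 ^ k)) (sym (ℤ.*-identityʳ x)) ⟩
  (x ^ℤ 2) ^ℤ (2 ^ k)               ≡⟨ ℤ.^-*-assoc x 2 (2 ^ k) ⟩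
  x ^ℤ (2 ^ suc k)                   ∎
  where open ≡-Reasoning

squares-isSquareChain : ∀ k x → IsSquareChain (squares k x)
squares-isSquareChain (suc k) x {zero} _ = sym (get-squares-head k (x *ℤ x))
squares-isSquareChain (suc k) x {suc i} (s≤s i<k) = squares-isSquareChain k (x *ℤ x) i<k

isSquareChain⇒≡squares : ∀ {k} (p : Vec ℤ (suc k)) → IsSquareChain p → p ≡ squares k (get p 1)
isSquareChain⇒≡squares {zero} (x ∷ []) _ = refl
isSquareChain⇒≡squares {suc k} (x ∷ p) chain = cong (x ∷_) (begin
  p                   ≡⟨ isSquareChain⇒≡squares p (chain ∘ s≤s) ⟩
  squares k (get p 1) ≡⟨ cong (squares k) (sym (chain (s≤s z≤n))) ⟩
  squares k (x *ℤ x)  ∎)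
  where open ≡-Reasoning

join : ∀ k → Vec ℤ (suc k) → Vec ℤ 11 → Vec ℤ (12 + k)
join zero (x ∷ []) w = x ∷ w
join (suc k) (x ∷ p) w = x ∷ join k p w

prefix : ∀ k → Vec ℤ (12 + k) → Vec ℤ (suc k)
prefix zero (x ∷ _) = x ∷ []
prefix (suc k) (x ∷ v) = x ∷ prefix k v

suffix : ∀ k → Vec ℤ (12 + k) → Vec ℤ 11
suffix zero (_ ∷ w) = w
suffix (suc k) (_ ∷ v) = suffix k v

suffix-join : ∀ k p w → suffix k (join k p w) ≡ w
suffix-join zero (_ ∷ []) w = refl
suffix-join (suc k) (_ ∷ p) w = suffix-join k p w

join-prefix-suffix : ∀ k v → join k (prefix k v) (suffix k v) ≡ v
join-prefix-suffix zero (_ ∷ _) = refl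
join-prefix-suffix (suc k) (x ∷ v) = cong (x ∷_) (join-prefix-suffix k v)

get-join-prefix : ∀ k p w {i} → i ≤ k → get (join k p w) (suc i) ≡ get p (suc i)
get-join-prefix zero (_ ∷ []) w z≤n = refl
get-join-prefix (suc k) (_ ∷ p) w {zero} _ = refl
get-join-prefix (suc k) (_ ∷ p) w {suc i} (s≤s i≤k) = get-join-prefix k p w i≤k

get-join-suffix : ∀ k p w i → get (join k p w) (suc (suc (i + k))) ≡ get w (suc i)
get-join-suffix zero (_ ∷ []) w i rewrite ℕ.+-identityʳ i = refl
get-join-suffix (suc k) (_ ∷ p) w i rewrite ℕ.+-suc i k = get-join-suffix k p w i

get-prefix : ∀ k v {i} → i ≤ k → get (prefix k v) (suc i) ≡ get v (suc i)
get-prefix zero (_ ∷ _) z≤n = refl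
get-prefix (suc k) (_ ∷ v) {zero} _ = refl
get-prefix (suc k) (_ ∷ v) {suc i} (s≤s i≤k) = get-prefix k v i≤k

get-join-tailIndex : ∀ k p w i →
  get (join k p w) (tailIndex k i) ≡ get (get p 1 ∷ get p (suc k) ∷ w) i
get-join-tailIndex k p w zero = get-zero (join k p w)
get-join-tailIndex k p w (suc zero) = get-join-prefix k p w z≤n
get-join-tailIndex k p w (suc (suc zero)) = get-join-prefix k p w ℕ.≤-refl
get-join-tailIndex k p w (suc (suc (suc i))) = get-join-suffix k p w i

Tail : Set
Tail = ℤ × Vec ℤ 11

TailEqs : ℕ → Tail → Set
TailEqs N (X , w) = All (Sat (X ∷ X ^ℤ N ∷ w)) tailSystem

TailSolution : ℕ → Set
TailSolution N = Σ Tail (TailEqs N)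

fromTail : ∀ k → Tail → Vec ℤ (12 + k)
fromTail k (X , w) = join k (squares k X) w

toTail : ∀ k → Vec ℤ (12 + k) → Tail
toTail k v = get v 1 , suffix k v

toTail-fromTail : ∀ k t → toTail k (fromTail k t) ≡ t
toTail-fromTail k (X , w) =
  cong₂ _,_ (trans (get-join-prefix k _ w z≤n) (get-squares-head k X)) (suffix-join k _ w)

fromTail-toTail : ∀ k {v} → All (Sat v) (chainSystem k) → fromTail k (toTail k v) ≡ v
fromTail-toTail k {v} chain = begin
  join k (squares k (get v 1)) (suffix k v)             ≡⟨ cong (λ p → join k p (suffix k v)) prefix≡squares ⟨
  join k (prefix k v) (suffix k v)                      ≡⟨ join-prefix-suffix k v ⟩
  v                                                     ∎
  where
  open ≡-Reasoning
  prefix-isSquareChain : IsSquareChain (prefix k v)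
  prefix-isSquareChain {i} i<k = begin
    get (prefix k v) (suc i) *ℤ get (prefix k v) (suc i)
      ≡⟨ cong₂ _*ℤ_ (get-prefix k v (ℕ.<⇒≤ i<k)) (get-prefix k v (ℕ.<⇒≤ i<k)) ⟩
    get v (suc i) *ℤ get v (suc i)  ≡⟨ Equivalence.to (All-chainSystem⇔ k) chain i<k ⟩
    get v (suc (suc i))             ≡⟨ get-prefix k v i<k ⟨
    get (prefix k v) (suc (suc i))  ∎
  prefix≡squares : prefix k v ≡ squares k (get v 1)
  prefix≡squares = trans (isSquareChain⇒≡squares _ prefix-isSquareChain)
                         (cong (squares k) (get-prefix k v z≤n))

solution⇔tailEqs : ∀ k t → All (Sat (fromTail k t)) (T (12 + k)) ⇔ TailEqs (2 ^ k) t
solution⇔tailEqs k (X , w) =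
  mk⇔ (Equivalence.to tail⇔ ∘ ++⁻ʳ (chainSystem k)) (++⁺ chain ∘ Equivalence.from tail⇔)
  where
  tail⇔ = All-Sat-rename (tailIndex k) (λ i → trans (get-join-tailIndex k _ w i)
            (cong₂ (λ x y → get (x ∷ y ∷ w) i) (get-squares-head k X) (get-squares-last k X)))
            tailSystem
  chain : All (Sat (join k (squares k X) w)) (chainSystem k)
  chain = Equivalence.from (All-chainSystem⇔ k) λ {i} i<k → begin
    get (join k (squares k X) w) (suc i) *ℤ get (join k (squares k X) w) (suc i)
      ≡⟨ cong₂ _*ℤ_ (get-join-prefix k _ w (ℕ.<⇒≤ i<k)) (get-join-prefix k _ w (ℕ.<⇒≤ i<k)) ⟩
    get (squares k X) (suc i) *ℤ get (squares k X) (suc i)  ≡⟨ squares-isSquareChain k X i<k ⟩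
    get (squares k X) (suc (suc i))                          ≡⟨ get-join-prefix k _ w i<k ⟨
    get (join k (squares k X) w) (suc (suc i))               ∎
    where open ≡-Reasoning

solution↔tailSolution : ∀ k → Solution (12 + k) ↔ TailSolution (2 ^ k)
solution↔tailSolution k = Σ-↔-irrelevant (All.irrelevant Sat-irrelevant) (All.irrelevant Sat-irrelevant)
  (toTail k) (fromTail k)
  (λ {v} sat → Equivalence.to (solution⇔tailEqs k (toTail k v))
                 (subst (λ u → All (Sat u) (T (12 + k))) (sym (fromTail-toTail k (++⁻ˡ _ sat))) sat))
  (Equivalence.from (solution⇔tailEqs k _))
  (λ {t} _ → toTail-fromTail k t)
  (λ sat → fromTail-toTail k (++⁻ˡ (chainSystem k) sat))

-- The last eleven equations

CofactorTriples : ℕ → Set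
CofactorTriples N = Σ ℤ (λ d → Cofactor N d × Triple (((+ 2) +ℤ d) ^ℤ N))

zeroTail : Tail
zeroTail = + 0 , replicate 11 (+ 0)

tailEqs-zeroTail : ∀ N .{{_ : NonZero N}} → TailEqs N zeroTail
tailEqs-zeroTail N =
  refl ∷ refl ∷ refl ∷ sym (0^n≡0 N) ∷ refl ∷ refl ∷ refl ∷ refl ∷ refl ∷ sym (0^n≡0 N) ∷ []

tailEqs⇒zeroTail : ∀ {N X w} → TailEqs N (X , + 0 ∷ w) → (X , + 0 ∷ w) ≡ zeroTail
tailEqs⇒zeroTail {N} {X} {_ ∷ w₃ ∷ _ ∷ w₅ ∷ _ ∷ w₇ ∷ _ ∷ w₉ ∷ _ ∷ _ ∷ []}
  (_ ∷ refl ∷ w₃+0≡X ∷ w₃*0≡X^N ∷ refl ∷ refl ∷ refl ∷ refl ∷ refl ∷ sum≡X^N ∷ [])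
  with ℤ.i^n≡0⇒i≡0 X N (trans (sym w₃*0≡X^N) (ℤ.*-zeroʳ w₃))
... | refl with trans (sym (ℤ.+-identityʳ w₃)) w₃+0≡X
... | refl with sum-of-squares≡0 w₅ w₇ w₉ (trans (ℤ.+-comm _ (w₉ *ℤ w₉)) (trans sum≡X^N (sym w₃*0≡X^N)))
... | refl , refl , refl = refl

tailSolution↔⊤⊎CofactorTriples : ∀ N .{{_ : NonZero N}} → TailSolution N ↔ (⊤ ⊎ CofactorTriples N)
tailSolution↔⊤⊎CofactorTriples N = mk↔ₛ′ classify build classify∘build build∘classify
  where
  classify : TailSolution N → ⊤ ⊎ CofactorTriples N
  classify ((X , w₁ ∷ _ ∷ w₃ ∷ w₄ ∷ w₅ ∷ _ ∷ w₇ ∷ _ ∷ w₉ ∷ _ ∷ _ ∷ []) ,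
            w₁²≡w₁ ∷ refl ∷ w₃+w₂≡X ∷ w₃*w₄≡X^N ∷ _ ∷ refl ∷ refl ∷ refl ∷ refl ∷ sum≡X^N ∷ [])
    with *-idem⇒0∨1 w₁ w₁²≡w₁
  ... | inj₁ _ = inj₁ tt
  ... | inj₂ refl = inj₂ (w₃ , (w₄ , trans w₃*w₄≡X^N (cong (_^ℤ N) X≡2+w₃)) ,
                          (w₅ , w₇ , w₉ , trans (ℤ.+-comm _ (w₉ *ℤ w₉)) (trans sum≡X^N (cong (_^ℤ N) X≡2+w₃))))
    where X≡2+w₃ = trans (sym w₃+w₂≡X) (ℤ.+-comm w₃ (+ 2))

  build : ⊤ ⊎ CofactorTriples N → TailSolution N
  build (inj₁ tt) = zeroTail , tailEqs-zeroTail N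
  build (inj₂ (d , (q , dq≡) , (a , b , c , a²+b²+c²≡))) =
    ((+ 2) +ℤ d , + 1 ∷ + 2 ∷ d ∷ q ∷ a ∷ a *ℤ a ∷ b ∷ b *ℤ b ∷ c ∷ c *ℤ c ∷ a *ℤ a +ℤ b *ℤ b ∷ []) ,
    refl ∷ refl ∷ ℤ.+-comm d (+ 2) ∷ dq≡ ∷ ℤ.*-identityˡ q ∷ refl ∷ refl ∷ refl ∷ refl ∷
    trans (ℤ.+-comm (c *ℤ c) _) a²+b²+c²≡ ∷ []

  classify∘build : ∀ x → classify (build x) ≡ x
  classify∘build (inj₁ tt) = refl
  classify∘build (inj₂ (d , (q , _) , (a , b , c , _))) =
    cong₂ (λ dq≡ a²+b²+c²≡ → inj₂ (d , (q , dq≡) , (a , b , c , a²+b²+c²≡))) (≡-irrelevant _ _) (≡-irrelevant _ _)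

  build∘classify : ∀ s → build (classify s) ≡ s
  build∘classify s@((X , w₁ ∷ _ ∷ w₃ ∷ _ ∷ _ ∷ _ ∷ _ ∷ _ ∷ _ ∷ _ ∷ _ ∷ []) ,
                    w₁²≡w₁ ∷ refl ∷ w₃+w₂≡X ∷ _ ∷ _ ∷ refl ∷ refl ∷ refl ∷ refl ∷ _ ∷ [])
    with *-idem⇒0∨1 w₁ w₁²≡w₁
  ... | inj₁ refl = Σ-≡-irrelevant (All.irrelevant Sat-irrelevant) (sym (tailEqs⇒zeroTail {N} (proj₂ s)))
  ... | inj₂ refl = Σ-≡-irrelevant (All.irrelevant Sat-irrelevant)
                      (cong (_, _) (trans (ℤ.+-comm (+ 2) w₃) w₃+w₂≡X))

PowerTriples : ℕ → Set
PowerTriples N = Σ ℕ (λ j → j < suc N ×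
  (Triple (((+ 2) +ℤ ((+ 2) ^ℤ j)) ^ℤ N) ⊎ Triple (((+ 2) -ℤ ((+ 2) ^ℤ j)) ^ℤ N)))

cofactorTriples↔powerTriples : ∀ N → CofactorTriples N ↔ PowerTriples N
cofactorTriples↔powerTriples N = mk↔ₛ′ to from to∘from from∘to
  where
  byExponent : ∀ {d} → Triple (((+ 2) +ℤ d) ^ℤ N) → SignedPowerOfTwo N d → PowerTriples N
  byExponent t (j , j≤N , inj₁ refl) = j , s≤s j≤N , inj₁ t
  byExponent t (j , j≤N , inj₂ refl) = j , s≤s j≤N , inj₂ t

  to : CofactorTriples N → PowerTriples N
  to (d , c , t) = byExponent t (cofactor⇒signedPowerOfTwo {N} {d} c)

  from : PowerTriples N → CofactorTriples N
  from (j , s≤s j≤N , inj₁ t) = _ , signedPowerOfTwo⇒cofactor (j , j≤N , inj₁ refl) , t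
  from (j , s≤s j≤N , inj₂ t) = _ , signedPowerOfTwo⇒cofactor (j , j≤N , inj₂ refl) , t

  to∘byExponent : ∀ {d} t (s : SignedPowerOfTwo N d) →
    to (d , signedPowerOfTwo⇒cofactor s , t) ≡ byExponent t s
  to∘byExponent {d} t s = cong (byExponent t)
    (signedPowerOfTwo-irrelevant (cofactor⇒signedPowerOfTwo {N} {d} (signedPowerOfTwo⇒cofactor s)) s)

  to∘from : ∀ x → to (from x) ≡ x
  to∘from (j , s≤s j≤N , inj₁ t) = to∘byExponent t (j , j≤N , inj₁ refl)
  to∘from (j , s≤s j≤N , inj₂ t) = to∘byExponent t (j , j≤N , inj₂ refl)

  from∘byExponent : ∀ {d} (c : Cofactor N d) t s → from (byExponent t s) ≡ (d , c , t)
  from∘byExponent {d} c t s@(_ , _ , inj₁ refl) =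
    cong (λ c → d , c , t) (cofactor-irrelevant {N} {d} (signedPowerOfTwo⇒cofactor s) c)
  from∘byExponent {d} c t s@(_ , _ , inj₂ refl) =
    cong (λ c → d , c , t) (cofactor-irrelevant {N} {d} (signedPowerOfTwo⇒cofactor s) c)

  from∘to : ∀ x → from (to x) ≡ x
  from∘to (d , c , t) = from∘byExponent c t (cofactor⇒signedPowerOfTwo {N} {d} c)

r₃[2±2^j]^N : (ℤ → ℕ) → ℕ → ℕ → ℕ
r₃[2±2^j]^N r₃ N j = r₃ (((+ 2) +ℤ ((+ 2) ^ℤ j)) ^ℤ N) + r₃ (((+ 2) -ℤ ((+ 2) ^ℤ j)) ^ℤ N)

Fin-sum-r₃↔⊤⊎PowerTriples : ∀ N (r₃ : ℤ → ℕ) → IsR3 r₃ →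
  Fin (1 + sum (map (r₃[2±2^j]^N r₃ N) (upTo (suc N)))) ↔ (⊤ ⊎ PowerTriples N)
Fin-sum-r₃↔⊤⊎PowerTriples N r₃ isR3 =
  ↔-trans +↔⊎ (1↔⊤ ⊎-↔ ↔-trans Fin-sum↔ (Σ-↔ ↔-refl (↔-refl ×-↔ ↔-trans +↔⊎ (isR3 _ ⊎-↔ isR3 _))))
  where
  f = r₃[2±2^j]^N r₃ N
  Fin-sum↔ : Fin (sum (map f (upTo (suc N)))) ↔ Σ ℕ (λ j → j < suc N × Fin (f j))
  Fin-sum↔ = subst (λ xs → Fin (sum xs) ↔ Σ ℕ (λ j → j < suc N × Fin (f j)))
                   (sym (map-upTo f (suc N))) (Fin-sum↔Σ< f (suc N))

theorem2 : (n : ℕ) → 12 ≤ n → (r₃ : ℤ → ℕ) → IsR3 r₃ →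
    All (InE n) (T n)
    × (Fin (1 + sum (map (λ k → r₃ (((+ 2) +ℤ ((+ 2) ^ℤ k)) ^ℤ (2 ^ (n ∸ 12))) + r₃ (((+ 2) -ℤ ((+ 2) ^ℤ k)) ^ℤ (2 ^ (n ∸ 12)))) (upTo (suc (2 ^ (n ∸ 12)))))) ↔ Solution n)
theorem2 n 12≤n r₃ isR3 with k , refl ← m≤n⇒∃[k]m+k≡n 12≤n = T⊆E k , (begin
  _                                  ↔⟨ Fin-sum-r₃↔⊤⊎PowerTriples (2 ^ k) r₃ isR3 ⟩
  (⊤ ⊎ PowerTriples (2 ^ k))         ↔⟨ ↔-refl ⊎-↔ cofactorTriples↔powerTriples (2 ^ k) ⟨
  (⊤ ⊎ CofactorTriples (2 ^ k))      ↔⟨ tailSolution↔⊤⊎CofactorTriples (2 ^ k) ⟨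
  TailSolution (2 ^ k)               ↔⟨ solution↔tailSolution k ⟨
  Solution (12 + k)                  ∎)
  where
  open EquationalReasoning
  instance _ = ℕ.m^n≢0 2 k
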